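{- Let $G^c$ be a vertex-coloured graph with $c$ colours on $n$ vertices with minimum degree $\delta(G^c)\ge n-c$. Then every rainbow set is a rainbow dominating set of $G^c$. Consequently, $\gamma^t(G^c)=c$.
   Context: A vertex-coloured graph $G^c$ is a finite simple undirected graph in which each vertex receives exactly one colour from $\{1,\dots,c\}$ and every colour is used at least once. A rainbow set is a set of $c$ vertices containing exactly one vertex of each colour. A dominating set is a vertex set $S$ such that every vertex is in $S$ or adjacent to a vertex of $S$; it is tropical if all $c$ colours appear in $S$; a rainbow dominating set is a tropical dominating set of size exactly $c$. $\gamma^t(G^c)$ (the tropical domination number) is the minimum size of a tropical dominating set. -}

module Defs where

open import Data.Nat using (ℕ; _∸_; _≤_)
open import Data.Bool using (Bool; true; false; T)
open import Data.Fin using (Fin)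
open import Data.Fin.Subset using (Subset; _∈_; ∣_∣)
open import Data.Vec using (countᵇ; tabulate)
open import Data.Product using (Σ; ∃; _×_; _,_)
open import Data.Sum using (_⊎_)
open import Relation.Binary.PropositionalEquality using (_≡_)
open import Relation.Nullary using (¬_)

record Graph (n : ℕ) : Set where
  field
    adj   : Fin n → Fin n → Bool
    sym   : ∀ u v → adj u v ≡ adj v u
    irrefl : ∀ v → adj v v ≡ false
open Graph public

record VColouring (n c : ℕ) : Set where
  field
    col  : Fin n → Fin c
    surj : ∀ (k : Fin c) → ∃ λ v → col v ≡ k
open VColouring public

Adjacent : ∀ {n} → Graph n → Fin n → Fin n → Set
Adjacent G u v = T (adj G u v)

degree : ∀ {n} → Graph n → Fin n → ℕ
degree G v = countᵇ (adj G v) (tabulate (λ u → u))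

MinDegreeAtLeast : ∀ {n} → Graph n → ℕ → Set
MinDegreeAtLeast G d = ∀ v → d ≤ degree G v

Dominating : ∀ {n} → Graph n → Subset n → Set
Dominating {n} G S = ∀ (v : Fin n) → v ∈ S ⊎ (∃ λ u → u ∈ S × Adjacent G u v)

Tropical : ∀ {n c} → VColouring n c → Subset n → Set
Tropical C S = ∀ k → ∃ λ v → v ∈ S × col C v ≡ k

RainbowSet : ∀ {n c} → VColouring n c → Subset n → Set
RainbowSet {c = c} C S =
  ∣ S ∣ ≡ c ×
  (∀ k → ∃ λ v → v ∈ S × col C v ≡ k) ×
  (∀ u v → u ∈ S → v ∈ S → col C u ≡ col C v → u ≡ v)

TropicalDominating : ∀ {n c} → Graph n → VColouring n c → Subset n → Set
TropicalDominating G C S = Dominating G S × Tropical C S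

RainbowDominating : ∀ {n c} → Graph n → VColouring n c → Subset n → Set
RainbowDominating {c = c} G C S = TropicalDominating G C S × ∣ S ∣ ≡ c

TropicalDominationNumber : ∀ {n c} → Graph n → VColouring n c → ℕ → Set
TropicalDominationNumber G C m =
  (∃ λ S → TropicalDominating G C S × ∣ S ∣ ≡ m) ×
  (∀ S → TropicalDominating G C S → m ≤ ∣ S ∣)

module Submission where

-- If a set S of size c misses a vertex v and no vertex
-- of S is adjacent to v, then S together with v lies in the complement of the
-- neighbourhood N(v); so c = ∣ S ∣ < ∣ ∁ N(v) ∣ = n ∸ deg v ≤ c, absurd.
-- Hence every rainbow set (indeed every c-set) dominates G.
--
-- For the tropical domination number: a tropical set S contains one vertex of
-- each colour, and these vertices are distinct, so c ≤ ∣ S ∣.  Conversely the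
-- image of a choice of one vertex per colour is a rainbow set, hence by the
-- first part a tropical dominating set of size exactly c.

open import Defs hiding (sym)
open import Data.Nat using (ℕ; zero; suc; _+_; _∸_; _≤_; _<_; s≤s; z≤n)
open import Data.Nat.Properties
  using (≤-trans; ≤-antisym; ≤-reflexive; <-irrefl; <-≤-trans; +-comm; +-suc; +-monoʳ-≤;
         m≤n+o⇒m∸n≤o; m≤n+m∸n; n≤1+n; module ≤-Reasoning)
open import Data.Bool using (Bool; true; false; T)
open import Data.Bool.Properties using (T?)
open import Data.Fin using (Fin; zero; suc)
open import Data.Fin.Properties using (any?; 0≢1+n; suc-injective)
open import Data.Fin.Subset
  using (Subset; _∈_; _∉_; _⊂_; ∁; ∣_∣; _∪_; ⁅_⁆; ⊥; _-_)
open import Data.Fin.Subset.Properties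
  using (_∈?_; ∣∁p∣≡n∸∣p∣; p⊂q⇒∣p∣<∣q∣; x∉p⇒x∈∁p; x∈p∧x≢y⇒x∈p-y; x∈p⇒∣p-x∣<∣p∣;
         x∈⁅x⁆; x∈⁅y⁆⇒x≡y; x∈p∪q⁺; x∈p∪q⁻; ∣⁅x⁆∣≡1; ∣⊥∣≡0; ∉⊥)
open import Data.Vec using (_∷_; []; countᵇ; tabulate)
open import Data.Vec.Properties using (lookup∘tabulate; []=⇒lookup)
open import Data.Product using (_×_; _,_; proj₁; proj₂; ∃)
open import Data.Sum using (inj₁; inj₂)
open import Data.Empty using (⊥-elim)
open import Function.Definitions using (Injective)
open import Relation.Nullary using (¬_; yes; no)
open import Relation.Nullary.Decidable using (_×-dec_)
open import Relation.Binary.PropositionalEquality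
  using (_≡_; refl; sym; trans; cong; subst)

∈-tabulate⁻ : ∀ {n} {f : Fin n → Bool} {x : Fin n} → x ∈ tabulate f → f x ≡ true
∈-tabulate⁻ {f = f} {x} x∈ = trans (sym (lookup∘tabulate f x)) ([]=⇒lookup x∈)

countᵇ-tabulate : ∀ {A : Set} {n} (p : A → Bool) (g : Fin n → A) →
  countᵇ p (tabulate g) ≡ ∣ tabulate (λ i → p (g i)) ∣
countᵇ-tabulate {n = zero}  p g = refl
countᵇ-tabulate {n = suc n} p g with p (g zero)
... | true  = cong suc (countᵇ-tabulate p (λ i → g (suc i)))
... | false = countᵇ-tabulate p (λ i → g (suc i))

injection⇒≤∣∣ : ∀ {m n} (f : Fin m → Fin n) (S : Subset n) →
  Injective _≡_ _≡_ f → (∀ k → f k ∈ S) → m ≤ ∣ S ∣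
injection⇒≤∣∣ {zero}  f S f-inj f∈S = z≤n
injection⇒≤∣∣ {suc m} f S f-inj f∈S =
  <-≤-trans (s≤s (injection⇒≤∣∣ (λ k → f (suc k)) (S - f zero) tail-inj tail∈))
            (x∈p⇒∣p-x∣<∣p∣ (f∈S zero))
  where
  tail-inj : Injective _≡_ _≡_ (λ k → f (suc k))
  tail-inj e = suc-injective (f-inj e)
  tail∈ : ∀ k → f (suc k) ∈ S - f zero
  tail∈ k = x∈p∧x≢y⇒x∈p-y (f∈S (suc k)) (λ e → 0≢1+n (sym (f-inj e)))

∣p∪q∣≤∣p∣+∣q∣ : ∀ {n} (p q : Subset n) → ∣ p ∪ q ∣ ≤ ∣ p ∣ + ∣ q ∣
∣p∪q∣≤∣p∣+∣q∣ []          []          = z≤n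
∣p∪q∣≤∣p∣+∣q∣ (true ∷ p)  (true ∷ q)  =
  s≤s (≤-trans (∣p∪q∣≤∣p∣+∣q∣ p q) (+-monoʳ-≤ ∣ p ∣ (n≤1+n ∣ q ∣)))
∣p∪q∣≤∣p∣+∣q∣ (true ∷ p)  (false ∷ q) = s≤s (∣p∪q∣≤∣p∣+∣q∣ p q)
∣p∪q∣≤∣p∣+∣q∣ (false ∷ p) (true ∷ q)  =
  subst (suc ∣ p ∪ q ∣ ≤_) (sym (+-suc ∣ p ∣ ∣ q ∣)) (s≤s (∣p∪q∣≤∣p∣+∣q∣ p q))
∣p∪q∣≤∣p∣+∣q∣ (false ∷ p) (false ∷ q) = ∣p∪q∣≤∣p∣+∣q∣ p q

image : ∀ {m n} → (Fin m → Fin n) → Subset n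
image {zero}  f = ⊥
image {suc m} f = ⁅ f zero ⁆ ∪ image (λ k → f (suc k))

∣image∣≤ : ∀ {m n} (f : Fin m → Fin n) → ∣ image f ∣ ≤ m
∣image∣≤ {zero}  {n} f = ≤-reflexive (∣⊥∣≡0 n)
∣image∣≤ {suc m} f =
  ≤-trans (∣p∪q∣≤∣p∣+∣q∣ ⁅ f zero ⁆ (image (λ k → f (suc k))))
          (subst (λ s → s + ∣ image (λ k → f (suc k)) ∣ ≤ suc m) (sym (∣⁅x⁆∣≡1 (f zero)))
                 (s≤s (∣image∣≤ (λ k → f (suc k)))))

∈-image⁺ : ∀ {m n} (f : Fin m → Fin n) k → f k ∈ image f
∈-image⁺ f zero    = x∈p∪q⁺ (inj₁ (x∈⁅x⁆ (f zero)))
∈-image⁺ f (suc k) = x∈p∪q⁺ (inj₂ (∈-image⁺ (λ i → f (suc i)) k))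

∈-image⁻ : ∀ {m n} (f : Fin m → Fin n) {v} → v ∈ image f → ∃ λ k → f k ≡ v
∈-image⁻ {zero}  f v∈ = ⊥-elim (∉⊥ v∈)
∈-image⁻ {suc m} f v∈ with x∈p∪q⁻ ⁅ f zero ⁆ (image (λ k → f (suc k))) v∈
... | inj₁ v∈⁅f0⁆ = zero , sym (x∈⁅y⁆⇒x≡y (f zero) v∈⁅f0⁆)
... | inj₂ v∈rest with ∈-image⁻ (λ k → f (suc k)) v∈rest
...   | k , fk≡v = suc k , fk≡v

neighbourhood : ∀ {n} → Graph n → Fin n → Subset n
neighbourhood G v = tabulate (adj G v)

degree≡∣neighbourhood∣ : ∀ {n} (G : Graph n) v → degree G v ≡ ∣ neighbourhood G v ∣
degree≡∣neighbourhood∣ G v = countᵇ-tabulate (adj G v) (λ u → u)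

-- A set missing v and containing no neighbour of v fits, together with v,
-- into the non-neighbours of v; hence it is smaller than n ∸ deg v.
isolated⇒small : ∀ {n} (G : Graph n) (S : Subset n) (v : Fin n) →
  v ∉ S → (∀ u → u ∈ S → ¬ Adjacent G u v) → ∣ S ∣ < n ∸ degree G v
isolated⇒small {n} G S v v∉S no-nbr = begin-strict
  ∣ S ∣                           <⟨ p⊂q⇒∣p∣<∣q∣ S⊂non-nbrs ⟩
  ∣ ∁ (neighbourhood G v) ∣        ≡⟨ ∣∁p∣≡n∸∣p∣ (neighbourhood G v) ⟩
  n ∸ ∣ neighbourhood G v ∣        ≡⟨ cong (n ∸_) (sym (degree≡∣neighbourhood∣ G v)) ⟩
  n ∸ degree G v                  ∎
  where
  open ≤-Reasoning
  nbr⇒adjacent : ∀ {u} → u ∈ neighbourhood G v → Adjacent G u v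
  nbr⇒adjacent {u} u∈N = subst T (trans (sym (∈-tabulate⁻ u∈N)) (Graph.sym G v u)) _
  S⊂non-nbrs : S ⊂ ∁ (neighbourhood G v)
  S⊂non-nbrs =
      (λ {u} u∈S → x∉p⇒x∈∁p (λ u∈N → no-nbr u u∈S (nbr⇒adjacent u∈N)))
    , v
    , x∉p⇒x∈∁p (λ v∈N → subst T (Graph.irrefl G v) (nbr⇒adjacent v∈N))
    , v∉S

<∸⇒¬∸≤ : ∀ {n s d} → s < n ∸ d → ¬ (n ∸ s ≤ d)
<∸⇒¬∸≤ {n} {s} {d} s<n∸d n∸s≤d = <-irrefl refl (<-≤-trans s<n∸d n∸d≤s)
  where
  n≤d+s : n ≤ d + s
  n≤d+s = ≤-trans (m≤n+m∸n n s)
                  (≤-trans (+-monoʳ-≤ s n∸s≤d) (≤-reflexive (+-comm s d)))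
  n∸d≤s : n ∸ d ≤ s
  n∸d≤s = m≤n+o⇒m∸n≤o n d n≤d+s

dense⇒dominating : ∀ {n} (G : Graph n) (S : Subset n) →
  MinDegreeAtLeast G (n ∸ ∣ S ∣) → Dominating G S
dense⇒dominating G S mindeg v with v ∈? S
... | yes v∈S = inj₁ v∈S
... | no  v∉S with any? (λ u → (u ∈? S) ×-dec T? (adj G u v))
...   | yes dominator = inj₂ dominator
...   | no  none      =
  ⊥-elim (<∸⇒¬∸≤ (isolated⇒small G S v v∉S (λ u u∈S uv → none (u , u∈S , uv))) (mindeg v))

-- A tropical set contains distinct representatives of all c colours.
tropical⇒≤∣∣ : ∀ {n c} (C : VColouring n c) (S : Subset n) → Tropical C S → c ≤ ∣ S ∣
tropical⇒≤∣∣ {n} {c} C S trop = injection⇒≤∣∣ rep S rep-inj (λ k → proj₁ (proj₂ (trop k)))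
  where
  rep : Fin c → Fin n
  rep k = proj₁ (trop k)
  rep-inj : Injective _≡_ _≡_ rep
  rep-inj {i} {j} e =
    trans (sym (proj₂ (proj₂ (trop i)))) (trans (cong (col C) e) (proj₂ (proj₂ (trop j))))

rainbowSet-exists : ∀ {n c} (C : VColouring n c) → ∃ λ S → RainbowSet C S
rainbowSet-exists {n} {c} C = S , size , tropical , one-per-colour
  where
  rep : Fin c → Fin n
  rep k = proj₁ (surj C k)
  col-rep : ∀ k → col C (rep k) ≡ k
  col-rep k = proj₂ (surj C k)
  S : Subset n
  S = image rep
  tropical : Tropical C S
  tropical k = rep k , ∈-image⁺ rep k , col-rep k
  size : ∣ S ∣ ≡ c
  size = ≤-antisym (∣image∣≤ rep) (tropical⇒≤∣∣ C S tropical)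
  one-per-colour : ∀ u v → u ∈ S → v ∈ S → col C u ≡ col C v → u ≡ v
  one-per-colour u v u∈S v∈S same-col with ∈-image⁻ rep u∈S | ∈-image⁻ rep v∈S
  ... | i , refl | j , refl = cong rep (trans (sym (col-rep i)) (trans same-col (col-rep j)))

mainTheorem2 : (n c : ℕ) (G : Graph n) (C : VColouring n c) →
    MinDegreeAtLeast G (n ∸ c) →
    (∀ S → RainbowSet C S → RainbowDominating G C S) × TropicalDominationNumber G C c
mainTheorem2 n c G C mindeg with rainbowSet-exists C
... | S₀ , rainbow₀ =
  rainbow⇒dominating , (S₀ , proj₁ (rainbow⇒dominating S₀ rainbow₀) , proj₁ rainbow₀) , lower-bound
  where
  -- a rainbow set has size c, so the degree bound is exactly the one needed
  rainbow⇒dominating : ∀ S → RainbowSet C S → RainbowDominating G C S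
  rainbow⇒dominating S (size , tropical , _) =
    (dense⇒dominating G S (subst (λ s → MinDegreeAtLeast G (n ∸ s)) (sym size) mindeg) , tropical)
    , size
  lower-bound : ∀ S → TropicalDominating G C S → c ≤ ∣ S ∣
  lower-bound S (_ , tropical) = tropical⇒≤∣∣ C S tropical
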